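{- Let $G=(V,E)$ be a simple connected graph with $n=|V|$ vertices and diameter $d$. Suppose $G$ has a dominating set of size $\gamma$. Then $f(G) \leq 2^{d+1}\gamma + n - 3\gamma + 1$.
   Context: A dominating set is a set $S\subseteq V$ such that every vertex not in $S$ is adjacent to some vertex of $S$. A distribution of pebbles on $G$ is a function $D: V \to \mathbb{N}$; its size is $\sum_v D(v)$. A pebbling step removes two pebbles from a vertex and places one pebble on an adjacent vertex. For a root vertex $v$, $D$ is $v$-solvable if at least one pebble can be placed on $v$ after some sequence of pebbling steps; $D$ is solvable if it is $v$-solvable for every $v\in V$. The pebbling number $f(G)$ is the smallest integer $N$ such that every distribution of size $N$ is solvable. -}

module Defs where

open import Data.Nat using (ℕ; zero; suc; _+_; _∸_; _≤_; _<_)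
open import Data.Fin using (Fin; _≟_)
open import Data.Fin.Subset using (Subset; _∈_; ∣_∣)
open import Data.Vec using (tabulate; sum)
open import Data.Product using (Σ; ∃; ∃-syntax; _×_; _,_)
open import Data.Sum using (_⊎_)
open import Relation.Nullary using (¬_; yes; no)
open import Relation.Binary.PropositionalEquality using (_≡_)

record Graph (n : ℕ) : Set₁ where
  field
    Adj     : Fin n → Fin n → Set
    sym     : ∀ {u v} → Adj u v → Adj v u
    irrefl  : ∀ {u} → ¬ Adj u u

module _ {n : ℕ} (G : Graph n) where
  open Graph G

  data Walk : Fin n → Fin n → ℕ → Set where
    nil  : ∀ {u} → Walk u u zero
    cons : ∀ {u w v k} → Adj u w → Walk w v k → Walk u v (suc k)

  DistLe : Fin n → Fin n → ℕ → Set
  DistLe u v k = ∃[ j ] (j ≤ k × Walk u v j)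

  Connected : Set
  Connected = ∀ u v → ∃[ k ] Walk u v k

  IsDiameter : ℕ → Set
  IsDiameter d = (∀ u v → DistLe u v d)
               × (∃[ u ] ∃[ v ] (∀ k → Walk u v k → d ≤ k))

  Dominating : Subset n → Set
  Dominating S = ∀ v → v ∈ S ⊎ (∃[ u ] (u ∈ S × Adj u v))

  Distribution : Set
  Distribution = Fin n → ℕ

  size : Distribution → ℕ
  size D = sum (tabulate D)

  move : Fin n → Fin n → Distribution → Distribution
  move u v D w with w ≟ u | w ≟ v
  ... | yes _ | _     = D w ∸ 2
  ... | no _  | yes _ = suc (D w)
  ... | no _  | no _  = D w

  data Reach : Distribution → Distribution → Set where
    done : ∀ {D} → Reach D D
    step : ∀ {D D'} u v → Adj u v → 2 ≤ D u → Reach (move u v D) D' → Reach D D'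

  RootSolvable : Distribution → Fin n → Set
  RootSolvable D r = ∃[ D' ] (Reach D D' × 1 ≤ D' r)

  Solvable : Distribution → Set
  Solvable D = ∀ r → RootSolvable D r

  AllSolvable : ℕ → Set
  AllSolvable N = ∀ (D : Distribution) → size D ≡ N → Solvable D

  IsPebblingNumber : ℕ → Set
  IsPebblingNumber N = AllSolvable N × (∀ M → M < N → ¬ AllSolvable M)

-- Send every vertex v to a dominator dom v ∈ S (v itself when v ∈ S). In one round of moves a
-- vertex s ∈ S can collect its load: its own pebbles plus ⌊D v/2⌋ from each v ∉ S it dominates.
-- If some load reaches 2^d, one pebble can be sent from s along a walk of length ≤ d to any
-- root. Otherwise the loads total at most γ(2^d − 1), and since D v ≤ 2⌊D v/2⌋ + 1 the size
-- of D is at most 2γ(2^d − 1) + (n − γ) = 2^(d+1)γ + n − 3γ.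
{-# OPTIONS --safe #-}
module Submission where

open import Defs
open import Data.Nat using (ℕ; _+_; _*_; _^_; _≤_)
open import Data.Fin.Subset using (Subset; ∣_∣)
open import Relation.Binary.PropositionalEquality using (_≡_)

open import Data.Nat using (zero; suc; _∸_; _<_; z≤n; s≤s; ⌊_/2⌋; _≤?_)
open import Data.Nat.Properties hiding (_≟_)
open import Data.Nat.Tactic.RingSolver using (solve-∀)
open import Data.Fin using (Fin; zero; suc; _≟_)
open import Data.Fin.Properties using (any?)
import Data.Fin.Properties as Fin
open import Data.Fin.Subset using (_∈_; _∉_; inside; outside)
open import Data.Fin.Subset.Properties using (_∈?_; ∣p∣≤n; drop-there)
open import Data.Bool using (if_then_else_)
import Data.Vec as Vec
open import Data.Vec using (here; there)
open import Data.Product using (Σ-syntax; ∃-syntax; _×_; _,_; proj₁)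
open import Data.Sum using (_⊎_; inj₁; inj₂)
open import Function using (_∘_; id)
open import Function.Definitions using (Injective)
open import Relation.Nullary using (does; yes; no; contradiction)
open import Relation.Nullary.Decidable using (_×-dec_)
open import Relation.Binary.PropositionalEquality
  using (_≢_; refl; sym; trans; cong; cong₂; subst)
open import Algebra.Properties.Semiring.Sum +-*-semiring
  using (sum-syntax; sum-cong-≗; sum-replicate-zero; ∑-distrib-+; ∑-comm; *-distribʳ-sum)

sum-tabulate : ∀ {m} (f : Fin m → ℕ) → Vec.sum (Vec.tabulate f) ≡ ∑[ i < m ] f i
sum-tabulate {zero}  f = refl
sum-tabulate {suc m} f = cong (f zero +_) (sum-tabulate (f ∘ suc))

∑-mono-≤ : ∀ {m} {f g : Fin m → ℕ} → (∀ i → f i ≤ g i) → ∑[ i < m ] f i ≤ ∑[ i < m ] g i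
∑-mono-≤ {zero}  f≤g = z≤n
∑-mono-≤ {suc m} f≤g = +-mono-≤ (f≤g zero) (∑-mono-≤ (f≤g ∘ suc))

∑-zero : ∀ {m} {f : Fin m → ℕ} → (∀ i → f i ≡ 0) → ∑[ i < m ] f i ≡ 0
∑-zero {m} f≡0 = trans (sum-cong-≗ f≡0) (sum-replicate-zero m)

∑-one : ∀ m → ∑[ i < m ] 1 ≡ m
∑-one zero    = refl
∑-one (suc m) = cong suc (∑-one m)

∑-δ : ∀ {m} (f : Fin m → ℕ) (a : Fin m) → ∑[ i < m ] (if does (i ≟ a) then f i else 0) ≡ f a
∑-δ {suc m} f zero    = trans (cong (f zero +_) (∑-zero {m} λ _ → refl)) (+-identityʳ (f zero))
∑-δ {suc m} f (suc a) = ∑-δ (f ∘ suc) a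

∑-fibres : ∀ {m k} (g : Fin m → Fin k) (f : Fin m → ℕ) →
           ∑[ s < k ] ∑[ i < m ] (if does (s ≟ g i) then f i else 0) ≡ ∑[ i < m ] f i
∑-fibres g f = trans (∑-comm (λ s i → if does (s ≟ g i) then f i else 0))
                     (sum-cong-≗ λ i → ∑-δ (λ _ → f i) (g i))

∑-indicator : ∀ {m} (S : Subset m) → ∑[ i < m ] (if does (i ∈? S) then 1 else 0) ≡ ∣ S ∣
∑-indicator Vec.[]            = refl
∑-indicator (outside Vec.∷ S) = ∑-indicator S
∑-indicator (inside Vec.∷ S)  = cong suc (∑-indicator S)

∑-bounded-on-support : ∀ {m B} (S : Subset m) (f : Fin m → ℕ) →
                       (∀ i → i ∈ S → f i < B) → (∀ i → i ∉ S → f i ≡ 0) →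
                       ∑[ i < m ] f i + ∣ S ∣ ≤ ∣ S ∣ * B
∑-bounded-on-support Vec.[] f _ _ = z≤n
∑-bounded-on-support (outside Vec.∷ S) f f<B f≡0 rewrite f≡0 zero λ () =
  ∑-bounded-on-support S (f ∘ suc)
    (λ i → f<B (suc i) ∘ there) (λ i i∉S → f≡0 (suc i) (i∉S ∘ drop-there))
∑-bounded-on-support {m = suc m} {B} (inside Vec.∷ S) f f<B f≡0 = begin
  (f zero + ∑[ i < m ] f (suc i)) + suc ∣ S ∣   ≡⟨ regroup (f zero) _ ∣ S ∣ ⟩
  suc (f zero) + (∑[ i < m ] f (suc i) + ∣ S ∣) ≤⟨ +-mono-≤ (f<B zero here) tail-bound ⟩
  B + ∣ S ∣ * B                                 ∎
  where
  open ≤-Reasoning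
  regroup : ∀ x y z → (x + y) + suc z ≡ suc x + (y + z)
  regroup = solve-∀
  tail-bound : ∑[ i < m ] f (suc i) + ∣ S ∣ ≤ ∣ S ∣ * B
  tail-bound =
    ∑-bounded-on-support S (f ∘ suc)
    (λ i → f<B (suc i) ∘ there) (λ i i∉S → f≡0 (suc i) (i∉S ∘ drop-there))

⌊n/2⌋*2≤n : ∀ n → ⌊ n /2⌋ * 2 ≤ n
⌊n/2⌋*2≤n 0             = z≤n
⌊n/2⌋*2≤n 1             = z≤n
⌊n/2⌋*2≤n (suc (suc n)) = s≤s (s≤s (⌊n/2⌋*2≤n n))

n≤⌊n/2⌋*2+1 : ∀ n → n ≤ ⌊ n /2⌋ * 2 + 1
n≤⌊n/2⌋*2+1 0             = z≤n
n≤⌊n/2⌋*2+1 1             = s≤s z≤n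
n≤⌊n/2⌋*2+1 (suc (suc n)) = s≤s (s≤s (n≤⌊n/2⌋*2+1 n))

module _ {n : ℕ} (G : Graph n) where
  open Graph G using (Adj; irrefl) renaming (sym to Adj-sym)

  Reach-trans : ∀ {D₁ D₂ D₃} → Reach G D₁ D₂ → Reach G D₂ D₃ → Reach G D₁ D₃
  Reach-trans done                 r₂ = r₂
  Reach-trans (step u v adj 2≤ r₁) r₂ = step u v adj 2≤ (Reach-trans r₁ r₂)

  move-source : ∀ u v D → move G u v D u ≡ D u ∸ 2
  move-source u v D with u ≟ u
  ... | yes _   = refl
  ... | no  u≢u = contradiction refl u≢u

  move-target : ∀ {u v} D → u ≢ v → move G u v D v ≡ suc (D v)
  move-target {u} {v} D u≢v with v ≟ u | v ≟ v
  ... | yes v≡u | _       = contradiction (sym v≡u) u≢v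
  ... | no  _   | yes _   = refl
  ... | no  _   | no  v≢v = contradiction refl v≢v

  move-≥ : ∀ {u v} D {w} → w ≢ u → D w ≤ move G u v D w
  move-≥ {u} {v} D {w} w≢u with w ≟ u | w ≟ v
  ... | yes w≡u | _     = contradiction w≡u w≢u
  ... | no  _   | yes _ = n≤1+n (D w)
  ... | no  _   | no  _ = ≤-refl

  push : ∀ {u v} → Adj u v → ∀ m D → m * 2 ≤ D u →
         ∃[ D' ] (Reach G D D' × D v + m ≤ D' v × (∀ w → w ≢ u → D w ≤ D' w))
  push adj zero D _ = D , done , ≤-reflexive (+-identityʳ _) , λ _ _ → ≤-refl
  push {u} {v} adj (suc m) D 2+2m≤ =
    let D' , r , v-gain , frame = push adj m (move G u v D) m*2≤
    in  D' , step u v adj (m+n≤o⇒m≤o 2 2+2m≤) r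
           , ≤-trans (≤-reflexive gained) v-gain
           , λ w w≢u → ≤-trans (move-≥ D w≢u) (frame w w≢u)
    where
    m*2≤ : m * 2 ≤ move G u v D u
    m*2≤ = subst (m * 2 ≤_) (sym (move-source u v D)) (∸-monoˡ-≤ 2 2+2m≤)
    gained : D v + suc m ≡ move G u v D v + m
    gained = trans (+-suc (D v) m)
                   (cong (_+ m) (sym (move-target D λ u≡v → irrefl (subst (Adj u) (sym u≡v) adj))))

  push-along : ∀ {u r j} → Walk G u r j → ∀ m D → 2 ^ j * m ≤ D u →
               ∃[ D' ] (Reach G D D' × m ≤ D' r)
  push-along nil m D m≤ = D , done , ≤-trans (m≤m+n m 0) m≤
  push-along {u} (cons {k = k} adj walk) m D 2^[1+k]m≤ =
    let D₁ , r₁ , gain , _ = push adj (2 ^ k * m) D (subst (_≤ D u) regroup 2^[1+k]m≤)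
        D₂ , r₂ , m≤      = push-along walk m D₁ (m+n≤o⇒n≤o _ gain)
    in  D₂ , Reach-trans r₁ r₂ , m≤
    where
    regroup : 2 ^ suc k * m ≡ 2 ^ k * m * 2
    regroup = trans (*-assoc 2 (2 ^ k) m) (*-comm 2 (2 ^ k * m))

  -- Pebbles are pushed from the sources ι 0, ι 1, … in turn; since ι is injective, a source is never
  -- drained before its own turn, which is what the last component records.
  gather : ∀ {k} s (ι : Fin k → Fin n) → Injective _≡_ _≡_ ι → (a : Fin k → ℕ) → ∀ D →
           (∀ i → a i ≡ 0 ⊎ Adj (ι i) s × a i * 2 ≤ D (ι i)) →
           ∃[ D' ] (Reach G D D' × D s + ∑[ i < k ] a i ≤ D' s
                                 × (∀ w → (∀ i → ι i ≢ w) → D w ≤ D' w))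
  gather {zero} s ι _ a D _ = D , done , ≤-reflexive (+-identityʳ (D s)) , λ _ _ → ≤-refl
  gather {suc k} s ι ι-inj a D feasible =
    let D₁ , r₁ , gain₁ , frame₁ = push-first (feasible zero)
        D' , r' , gain' , frame' = gather s (ι ∘ suc) (Fin.suc-injective ∘ ι-inj) (a ∘ suc) D₁
                                          (feasible-after {D₁} frame₁)
    in  D' , Reach-trans r₁ r'
           , ≤-trans (≤-reflexive (sym (+-assoc (D s) (a zero) _))) (≤-trans (+-monoˡ-≤ _ gain₁) gain')
           , λ w ∉ι → ≤-trans (frame₁ w (∉ι zero ∘ sym)) (frame' w (∉ι ∘ suc))
    where
    push-first : a zero ≡ 0 ⊎ Adj (ι zero) s × a zero * 2 ≤ D (ι zero) →
                 ∃[ D₁ ] (Reach G D D₁ × D s + a zero ≤ D₁ s × (∀ w → w ≢ ι zero → D w ≤ D₁ w))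
    push-first (inj₁ a₀≡0)          =
      D , done , ≤-reflexive (trans (cong (D s +_) a₀≡0) (+-identityʳ (D s))) , λ _ _ → ≤-refl
    push-first (inj₂ (adj , enough)) = push adj (a zero) D enough
    feasible-after : ∀ {D₁} → (∀ w → w ≢ ι zero → D w ≤ D₁ w) →
                     ∀ i → a (suc i) ≡ 0 ⊎ Adj (ι (suc i)) s × a (suc i) * 2 ≤ D₁ (ι (suc i))
    feasible-after frame i with feasible (suc i)
    ... | inj₁ a≡0            = inj₁ a≡0
    ... | inj₂ (adj , enough) = inj₂ (adj , ≤-trans enough (frame (ι (suc i)) (Fin.0≢1+n ∘ sym ∘ ι-inj)))

  Reach-solvable : ∀ {D D'} → Reach G D D' → Solvable G D' → Solvable G D
  Reach-solvable D→D' solvable r =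
    let D'' , D'→D'' , pebble = solvable r in D'' , Reach-trans D→D' D'→D'' , pebble

  solvable-from-hub : ∀ {s d D} → (∀ r → DistLe G s r d) → 2 ^ d ≤ D s → Solvable G D
  solvable-from-hub {d = d} {D} near 2^d≤ r =
    let j , j≤d , walk = near r
    in  push-along walk 1 D (≤-trans (≤-reflexive (*-identityʳ (2 ^ j))) (≤-trans (^-monoʳ-≤ 2 j≤d) 2^d≤))

  record Dominator (S : Subset n) : Set where
    field
      dom     : Fin n → Fin n
      dom∈S   : ∀ v → dom v ∈ S
      dom-fix : ∀ {v} → v ∈ S → dom v ≡ v
      dom-adj : ∀ {v} → v ∉ S → Adj (dom v) v

  dominator : ∀ {S} → Dominating G S → Dominator S
  dominator {S} dominating = record
    { dom     = proj₁ ∘ choose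
    ; dom∈S   = λ v → let _ , u∈S , _ , _ = choose v in u∈S
    ; dom-fix = λ {v} v∈S → let _ , _ , fix , _ = choose v in fix v∈S
    ; dom-adj = λ {v} v∉S → let _ , _ , _ , adj = choose v in adj v∉S
    }
    where
    choose : ∀ v → Σ[ u ∈ Fin n ] (u ∈ S × (v ∈ S → u ≡ v) × (v ∉ S → Adj u v))
    choose v with v ∈? S | dominating v
    ... | yes v∈S | _                   = v , v∈S , (λ _ → refl) , (λ v∉S → contradiction v∈S v∉S)
    ... | no  v∉S | inj₁ v∈S            = contradiction v∈S v∉S
    ... | no  v∉S | inj₂ (u , u∈S , adj) = u , u∈S , (λ v∈S → contradiction v∈S v∉S) , λ _ → adj

  module Loads {S : Subset n} (δ : Dominator S) (D : Distribution G) where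
    open Dominator δ

    collectable : Fin n → ℕ
    collectable v = if does (v ∈? S) then D v else ⌊ D v /2⌋

    share : Fin n → Fin n → ℕ
    share s v = if does (s ≟ dom v) then collectable v else 0

    load : Fin n → ℕ
    load s = ∑[ v < n ] share s v

    share≤ : ∀ s v → share s v ≤ D v
    share≤ s v with s ≟ dom v | v ∈? S
    ... | no  _ | _     = z≤n
    ... | yes _ | yes _ = ≤-refl
    ... | yes _ | no  _ = ⌊n/2⌋≤n (D v)

    load-outside : ∀ {s} → s ∉ S → load s ≡ 0
    load-outside {s} s∉S = ∑-zero share≡0
      where
      share≡0 : ∀ v → share s v ≡ 0
      share≡0 v with s ≟ dom v
      ... | yes s≡dom = contradiction (subst (_∈ S) (sym s≡dom) (dom∈S v)) s∉S
      ... | no  _     = refl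

    gather-load : ∀ s → ∃[ D' ] (Reach G D D' × load s ≤ D' s)
    gather-load s =
      let D' , D→D' , gain , _ = gather s id id amount D feasible
      in  D' , D→D' , ≤-trans load≤ gain
      where
      amount : Fin n → ℕ
      amount v = if does (v ≟ s) then 0 else share s v

      feasible : ∀ v → amount v ≡ 0 ⊎ Adj v s × amount v * 2 ≤ D v
      feasible v with v ≟ s | s ≟ dom v | v ∈? S
      ... | yes _   | _         | _       = inj₁ refl
      ... | no  _   | no  _     | _       = inj₁ refl
      ... | no  v≢s | yes s≡dom | yes v∈S = contradiction (sym (trans s≡dom (dom-fix v∈S))) v≢s
      ... | no  _   | yes s≡dom | no  v∉S =
        inj₂ (Adj-sym (subst (λ u → Adj u v) (sym s≡dom) (dom-adj v∉S)) , ⌊n/2⌋*2≤n (D v))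

      only-s : Fin n → ℕ
      only-s v = if does (v ≟ s) then D v else 0

      split : ∀ v → share s v ≤ only-s v + amount v
      split v with v ≟ s
      ... | yes refl = ≤-trans (share≤ s s) (m≤m+n (D s) 0)
      ... | no  _    = ≤-refl

      load≤ : load s ≤ D s + ∑[ v < n ] amount v
      load≤ = begin
        load s                                        ≤⟨ ∑-mono-≤ split ⟩
        ∑[ v < n ] (only-s v + amount v)              ≡⟨ ∑-distrib-+ only-s amount ⟩
        ∑[ v < n ] only-s v + ∑[ v < n ] amount v     ≡⟨ cong (_+ ∑[ v < n ] amount v) (∑-δ D s) ⟩
        D s + ∑[ v < n ] amount v                     ∎
        where open ≤-Reasoning

    size-bound : size G D + ∣ S ∣ ≤ ∑[ v < n ] collectable v * 2 + n
    size-bound = begin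
      size G D + ∣ S ∣                          ≡⟨ cong₂ _+_ (sum-tabulate D) (sym (∑-indicator S)) ⟩
      ∑[ v < n ] D v + ∑[ v < n ] [∈S] v        ≡⟨ ∑-distrib-+ D [∈S] ⟨
      ∑[ v < n ] (D v + [∈S] v)                 ≤⟨ ∑-mono-≤ pebbles≤ ⟩
      ∑[ v < n ] (collectable v * 2 + 1)        ≡⟨ ∑-distrib-+ (λ v → collectable v * 2) (λ _ → 1) ⟩
      ∑[ v < n ] (collectable v * 2) + ∑[ v < n ] 1
        ≡⟨ cong₂ _+_ (*-distribʳ-sum 2 collectable) (sym (∑-one n)) ⟨
      ∑[ v < n ] collectable v * 2 + n          ∎
      where
      open ≤-Reasoning
      [∈S] : Fin n → ℕ
      [∈S] v = if does (v ∈? S) then 1 else 0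
      pebbles≤ : ∀ v → D v + [∈S] v ≤ collectable v * 2 + 1
      pebbles≤ v with v ∈? S
      ... | yes _ = +-monoˡ-≤ 1 (m≤m*n (D v) 2)
      ... | no  _ = ≤-trans (≤-reflexive (+-identityʳ (D v))) (n≤⌊n/2⌋*2+1 (D v))

    light-loads⇒size≤ : ∀ d → (∀ s → s ∈ S → load s < 2 ^ d) →
                        size G D + 3 * ∣ S ∣ ≤ 2 ^ (d + 1) * ∣ S ∣ + n
    light-loads⇒size≤ d light = begin
      size G D + 3 * γ                          ≡⟨ regroup₁ (size G D) γ ⟩
      (size G D + γ) + γ * 2                    ≤⟨ +-monoˡ-≤ (γ * 2) size-bound ⟩
      (∑[ v < n ] collectable v * 2 + n) + γ * 2 ≡⟨ cong (λ x → x * 2 + n + γ * 2) ∑-loads ⟨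
      (∑[ s < n ] load s * 2 + n) + γ * 2       ≡⟨ regroup₂ (∑[ s < n ] load s) n γ ⟩
      (∑[ s < n ] load s + γ) * 2 + n           ≤⟨ +-monoˡ-≤ n (*-monoˡ-≤ 2 loads-bound) ⟩
      γ * 2 ^ d * 2 + n                         ≡⟨ cong (_+ n) (trans (regroup₃ γ (2 ^ d)) 2^d*2*γ≡) ⟩
      2 ^ (d + 1) * γ + n                       ∎
      where
      open ≤-Reasoning
      γ : ℕ
      γ = ∣ S ∣
      ∑-loads : ∑[ s < n ] load s ≡ ∑[ v < n ] collectable v
      ∑-loads = ∑-fibres dom collectable
      loads-bound : ∑[ s < n ] load s + γ ≤ γ * 2 ^ d
      loads-bound = ∑-bounded-on-support S load light (λ _ → load-outside)
      regroup₁ : ∀ x y → x + 3 * y ≡ (x + y) + y * 2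
      regroup₁ = solve-∀
      regroup₂ : ∀ x y z → (x * 2 + y) + z * 2 ≡ (x + z) * 2 + y
      regroup₂ = solve-∀
      regroup₃ : ∀ x y → x * y * 2 ≡ y * 2 * x
      regroup₃ = solve-∀
      2^d*2*γ≡ : 2 ^ d * 2 * γ ≡ 2 ^ (d + 1) * γ
      2^d*2*γ≡ = cong (_* γ) (sym (^-distribˡ-+-* 2 d 1))

    large⇒solvable : ∀ {d} → (∀ u v → DistLe G u v d) →
                     2 ^ (d + 1) * ∣ S ∣ + n < size G D + 3 * ∣ S ∣ → Solvable G D
    large⇒solvable {d} diam large with any? (λ s → (s ∈? S) ×-dec (2 ^ d ≤? load s))
    ... | yes (s , _ , heavy) =
      let D' , D→D' , load≤ = gather-load s
      in  Reach-solvable D→D' (solvable-from-hub (diam s) (≤-trans heavy load≤))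
    ... | no  no-heavy =
      contradiction (light-loads⇒size≤ d λ s s∈S → ≰⇒> λ heavy → no-heavy (s , s∈S , heavy))
                    (<⇒≱ large)

theorem4 : ∀ {n : ℕ} (G : Graph n) (d γ : ℕ) (S : Subset n) →
           Connected G → IsDiameter G d →
           Dominating G S → ∣ S ∣ ≡ γ →
           ∀ (f : ℕ) → IsPebblingNumber G f →
           f + 3 * γ ≤ 2 ^ (d + 1) * γ + n + 1
theorem4 {n} G d γ S _ (diam , _) dominating refl f (_ , minimal) = begin
  f + 3 * γ ≤⟨ +-monoˡ-≤ (3 * γ) f≤M ⟩
  M + 3 * γ ≡⟨ m∸n+n≡m 3γ≤X+1 ⟩
  X + 1     ∎
  where
  open ≤-Reasoning
  X M : ℕ
  X = 2 ^ (d + 1) * γ + n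
  M = X + 1 ∸ 3 * γ
  3γ≤X+1 : 3 * γ ≤ X + 1
  3γ≤X+1 = ≤-trans (+-mono-≤ (∣p∣≤n S) (*-monoˡ-≤ γ (^-monoʳ-≤ 2 (m≤n+m 1 d))))
                   (≤-trans (≤-reflexive (+-comm n _)) (m≤m+n X 1))
  X<M+3γ : X < M + 3 * γ
  X<M+3γ = ≤-reflexive (trans (+-comm 1 X) (sym (m∸n+n≡m 3γ≤X+1)))
  all-solvable : AllSolvable G M
  all-solvable D size≡M =
    Loads.large⇒solvable G (dominator G dominating) D diam
      (subst (λ m → X < m + 3 * γ) (sym size≡M) X<M+3γ)
  f≤M : f ≤ M
  f≤M = ≮⇒≥ λ M<f → minimal M M<f all-solvable
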